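{- Let $r \ge 3$ and let $s, n_1,\ldots, n_r$ be positive integers, $N = n_1+\cdots + n_r$. Then: (i) $\mu_{\rm t}(K_{n_1} \,\square\, \cdots \,\square\, K_{n_r}) \le \frac{6}{r!}\,N^{r-2}$; (ii) $\mu_{\rm t}(K_s^{\square, r}) \leq c_r'\,s^{r-2}$, where $c_r' = 3\prod_{i=3}^r (i-1)^{i-3}$.
   Context: For a connected graph $G$ and $X\subseteq V(G)$, two vertices $x,y$ are $X$-visible if there is a shortest $x,y$-path none of whose internal vertices lies in $X$. $X$ is a total mutual-visibility set if every two vertices of $V(G)$ are $X$-visible. $\mu_{\rm t}(G)$ is the maximum cardinality of a total mutual-visibility set of $G$. $\square$ denotes the Cartesian product of graphs (vertex set the Cartesian product of vertex sets; two tuples adjacent iff they differ in exactly one coordinate and in that coordinate the entries are adjacent in the corresponding factor). $K_n$ is the complete graph on $n$ vertices and $K_s^{\square, r}$ is the Cartesian product of $r$ copies of $K_s$. -}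

module Defs where

open import Data.Nat using (ℕ; zero; suc; _+_; _*_; _^_; _≤_)
open import Data.Fin using (Fin)
import Data.Fin as F
open import Data.List using (List)
open import Data.List.Relation.Unary.Any using (Any)
open import Data.List.Relation.Unary.AllPairs using (AllPairs)
open import Data.Product using (Σ; _×_)
open import Data.Unit using (⊤)
open import Relation.Nullary using (¬_)
open import Relation.Binary.PropositionalEquality using (_≡_)

-- A (simple) graph: a vertex type, a notion of vertex equality
-- (needed because vertices of product graphs are tuples, i.e. functions,
-- compared pointwise), and an adjacency relation.
record Graph : Set₁ where
  field
    V   : Set
    _≈_ : V → V → Set
    Adj : V → V → Set
open Graph public

K : ℕ → Graph
K n = record { V = Fin n ; _≈_ = _≡_ ; Adj = λ i j → ¬ i ≡ j }

□-prod : (r : ℕ) → (Fin r → Graph) → Graph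
□-prod r G = record
  { V   = (i : Fin r) → V (G i)
  ; _≈_ = λ u v → (i : Fin r) → _≈_ (G i) (u i) (v i)
  ; Adj = λ u v → Σ (Fin r) λ i →
            Adj (G i) (u i) (v i) ×
            ((j : Fin r) → ¬ j ≡ i → _≈_ (G j) (u j) (v j))
  }

KProd : (r : ℕ) → (Fin r → ℕ) → Graph
KProd r ns = □-prod r (λ i → K (ns i))

KPow : ℕ → ℕ → Graph
KPow s r = □-prod r (λ _ → K s)

module _ (G : Graph) where

  data Walk : V G → V G → Set where
    stop : ∀ {x y} → _≈_ G x y → Walk x y
    step : ∀ {x y z} → Adj G x y → Walk y z → Walk x z

  len : ∀ {x y} → Walk x y → ℕ
  len (stop _)   = 0
  len (step _ w) = suc (len w)

  IsShortest : ∀ {x y} → Walk x y → Set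
  IsShortest {x} {y} w = (w' : Walk x y) → len w ≤ len w'

  _∈V_ : V G → List (V G) → Set
  v ∈V X = Any (λ u → _≈_ G u v) X

  private
    AllButLastAvoid : List (V G) → ∀ {x y} → Walk x y → Set
    AllButLastAvoid X (stop _) = ⊤
    AllButLastAvoid X (step {x = x} _ w) = ¬ (x ∈V X) × AllButLastAvoid X w

  InternalAvoid : List (V G) → ∀ {x y} → Walk x y → Set
  InternalAvoid X (stop _)   = ⊤
  InternalAvoid X (step _ w) = AllButLastAvoid X w

  Visible : List (V G) → V G → V G → Set
  Visible X x y = Σ (Walk x y) λ w → IsShortest w × InternalAvoid X w

  TotalMutualVisibility : List (V G) → Set
  TotalMutualVisibility X = (x y : V G) → Visible X x y

  -- X is a set of vertices: a list without repetitions; |X| = its length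
  DistinctVerts : List (V G) → Set
  DistinctVerts X = AllPairs (λ u v → ¬ _≈_ G u v) X

∑ : (r : ℕ) → (Fin r → ℕ) → ℕ
∑ zero    f = 0
∑ (suc r) f = f F.zero + ∑ r (λ i → f (F.suc i))

∏c : ℕ → ℕ
∏c 0 = 1
∏c 1 = 1
∏c 2 = 1
∏c (suc (suc (suc k))) = (2 + k) ^ k * ∏c (suc (suc k))

c′ : ℕ → ℕ
c′ r = 3 * ∏c r

{-# OPTIONS --safe #-}
-- In a product of complete graphs, a total mutual-visibility set X never contains two
-- vertices x, y differing in exactly two coordinates i, j: the only shortest paths from
-- x[i←y] to x[j←y] run through x or through y.  For such distance-two-free sets,
-- r! |X| ≤ 6 N^(r-2) follows by induction on r ≥ 3.  For r = 3, send x ∈ X to its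
-- coordinate in a direction d where x has a partner in X (a member differing from x only
-- at d), or, if no direction has one, to any coordinate; regarded as an element of the
-- disjoint union of the coordinate ranges (of size N) this is injective on X.  For r > 3,
-- each layer x_i = const is distance-two-free in dimension r - 1, so
-- (r-1)! |X| ≤ n_i · 6 N^(r-3) for every i, and summing over i gives r! |X| ≤ 6 N^(r-2).
-- Part (ii) is part (i) with N = r s, since 6 r^(r-2) ≤ r! c′_r.
module Submission where

open import Defs
open import Data.Nat using (ℕ; _!; _+_; _*_; _∸_; _^_; _≤_; _<_)
open import Data.Fin using (Fin)
open import Data.List using (List; length)
open import Data.Product using (_×_)

open import Data.Bool using (true; false)
open import Data.Empty using (⊥-elim)
import Data.Fin as Fin
open import Data.Fin using (toℕ; punchIn; _↑ˡ_; _↑ʳ_; splitAt)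
open import Data.Fin.Properties
  using (toℕ<n; toℕ-injective; punchIn-injective; punchIn-punchOut; punchInᵢ≢i;
         ↑ˡ-injective; ↑ʳ-injective; splitAt-↑ˡ; splitAt-↑ʳ)
  renaming (_≟_ to _≟ᶠ_; any? to anyᶠ?; all? to allᶠ?)
open import Data.List using ([]; _∷_; map; filter)
open import Data.List.Properties using (length-map)
open import Data.List.Membership.Propositional using (_∈_; find; lose)
open import Data.List.Membership.Propositional.Properties using (∈-map⁻; ∈-filter⁻)
open import Data.List.Relation.Binary.Sublist.Propositional.Properties
  using (filter-⊆; length-mono-≤)
import Data.List.Relation.Binary.Sublist.Propositional.Properties as Sublistₚ
open import Data.List.Relation.Unary.All as All using (All; []; _∷_)
import Data.List.Relation.Unary.All.Properties as Allₚ
open import Data.List.Relation.Unary.Any as Any using (Any; here; there; any?)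
open import Data.List.Relation.Unary.AllPairs as AllPairs using (AllPairs; []; _∷_)
import Data.List.Relation.Unary.AllPairs.Properties as AllPairsₚ
open import Data.List.Relation.Unary.Unique.Propositional using (Unique)
open import Data.Nat using (zero; suc; z≤n; s≤s; s≤s⁻¹; _≟_)
open import Data.Nat.Properties
open import Algebra.Properties.CommutativeMonoid.Sum +-0-commutativeMonoid using (sum; sum-remove)
open import Algebra.Properties.CommutativeSemigroup *-commutativeSemigroup
  using (interchange; x∙yz≈y∙xz)
open import Data.Nat.Solver using (module +-*-Solver)
open import Data.Product using (∃; ∃₂; _,_; proj₁; proj₂)
open import Data.Sum using (_⊎_; inj₁; inj₂)
open import Function using (_∘_)
open import Level using (Level)
open import Relation.Binary.PropositionalEquality
open import Relation.Nullary using (¬_; Dec; does; yes; no; contradiction)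
open import Relation.Nullary.Decidable using (¬?; _×-dec_; _→-dec_; decidable-stable)
open import Relation.Unary using (Decidable)
open import Relation.Unary.Properties using (∁?)

private
  variable
    ℓ ℓ′ : Level
    A : Set ℓ
    r : ℕ

AllPairs-mapWith∈ : ∀ {R S : A → A → Set ℓ′} {xs : List A} → AllPairs R xs →
                    (∀ {x y} → x ∈ xs → y ∈ xs → R x y → S x y) → AllPairs S xs
AllPairs-mapWith∈ []         f = []
AllPairs-mapWith∈ (Rx ∷ Rxs) f =
  All.tabulate (λ y∈xs → f (here refl) (there y∈xs) (All.lookup Rx y∈xs)) ∷
  AllPairs-mapWith∈ Rxs (λ x∈xs y∈xs → f (there x∈xs) (there y∈xs))

length-filter-∁ : ∀ {P : A → Set ℓ′} (P? : Decidable P) (xs : List A) →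
                  length xs ≡ length (filter P? xs) + length (filter (∁? P?) xs)
length-filter-∁ P? []       = refl
length-filter-∁ P? (x ∷ xs) with does (P? x)
... | true  = cong suc (length-filter-∁ P? xs)
... | false = trans (cong suc (length-filter-∁ P? xs)) (sym (+-suc _ _))

fibre : (A → ℕ) → ℕ → List A → List A
fibre k v = filter (λ x → k x ≟ v)

∈-fibre⁻ : (k : A → ℕ) {v : ℕ} {xs : List A} {x : A} → x ∈ fibre k v xs → x ∈ xs × k x ≡ v
∈-fibre⁻ k {v} {xs} = ∈-filter⁻ (λ x → k x ≟ v) {xs = xs}

*-length-≤-fibres : (k : A → ℕ) {c B : ℕ} (n : ℕ) {xs : List A} → All (λ x → k x < n) xs →
                    (∀ v → v < n → c * length (fibre k v xs) ≤ B) → c * length xs ≤ n * B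
*-length-≤-fibres k {c}     zero    []       _      = ≤-reflexive (*-zeroʳ c)
*-length-≤-fibres k {c} {B} (suc n) {xs} k<1+n fibre≤ = begin
  c * length xs                                 ≡⟨ cong (c *_) (length-filter-∁ top? xs) ⟩
  c * (length (fibre k n xs) + length rest)     ≡⟨ *-distribˡ-+ c _ _ ⟩
  c * length (fibre k n xs) + c * length rest
    ≤⟨ +-mono-≤ (fibre≤ n ≤-refl) (*-length-≤-fibres k {c} {B} n rest<n rest-fibre≤) ⟩
  B + n * B                                     ∎
  where
  open ≤-Reasoning
  top? = λ x → k x ≟ n
  rest = filter (∁? top?) xs
  rest<n : All (λ x → k x < n) rest
  rest<n = All.zipWith (λ (k<1+n , k≢n) → ≤∧≢⇒< (s≤s⁻¹ k<1+n) k≢n)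
                       (Allₚ.filter⁺ (∁? top?) k<1+n , Allₚ.all-filter (∁? top?) xs)
  rest-fibre≤ : ∀ v → v < n → c * length (fibre k v rest) ≤ B
  rest-fibre≤ v v<n = ≤-trans
    (*-monoʳ-≤ c (length-mono-≤ (Sublistₚ.filter⁺ _ _ (λ { refl p → p }) (filter-⊆ (∁? top?) xs))))
    (fibre≤ v (m<n⇒m<1+n v<n))

fibre-length≤1 : (k : A → ℕ) {xs : List A} → AllPairs (λ x y → k x ≢ k y) xs →
                 ∀ v → length (fibre k v xs) ≤ 1
fibre-length≤1 k {xs} distinct v = go (AllPairsₚ.filter⁺ _ distinct) (Allₚ.all-filter _ xs)
  where
  go : ∀ {ys} → AllPairs (λ x y → k x ≢ k y) ys → All (λ x → k x ≡ v) ys → length ys ≤ 1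
  go []                 _                   = z≤n
  go (_ ∷ [])           _                   = s≤s z≤n
  go ((kx≢ky ∷ _) ∷ _)  (kx≡v ∷ ky≡v ∷ _)  = ⊥-elim (kx≢ky (trans kx≡v (sym ky≡v)))

Unique⇒length≤ : ∀ {n} {xs : List (Fin n)} → Unique xs → length xs ≤ n
Unique⇒length≤ {n} {xs} distinct = begin
  length xs      ≡⟨ sym (*-identityˡ _) ⟩
  1 * length xs  ≤⟨ *-length-≤-fibres toℕ {1} {1} n {xs} (All.tabulate (λ {i} _ → toℕ<n i)) fibre≤1 ⟩
  n * 1          ≡⟨ *-identityʳ n ⟩
  n              ∎
  where
  open ≤-Reasoning
  fibre≤1 : ∀ v → v < n → 1 * length (fibre toℕ v xs) ≤ 1
  fibre≤1 v _ = ≤-trans (≤-reflexive (*-identityˡ _))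
    (fibre-length≤1 toℕ (AllPairs.map (λ i≢j → i≢j ∘ toℕ-injective) distinct) v)

∑-const : ∀ r c → ∑ r (λ _ → c) ≡ r * c
∑-const zero    c = refl
∑-const (suc r) c = cong (c +_) (∑-const r c)

∑-mono-≤ : ∀ r {f g : Fin r → ℕ} → (∀ i → f i ≤ g i) → ∑ r f ≤ ∑ r g
∑-mono-≤ zero    f≤g = z≤n
∑-mono-≤ (suc r) f≤g = +-mono-≤ (f≤g Fin.zero) (∑-mono-≤ r (f≤g ∘ Fin.suc))

*-distribʳ-∑ : ∀ r (f : Fin r → ℕ) c → ∑ r f * c ≡ ∑ r (λ i → f i * c)
*-distribʳ-∑ zero    f c = refl
*-distribʳ-∑ (suc r) f c =
  trans (*-distribʳ-+ c (f Fin.zero) _) (cong (f Fin.zero * c +_) (*-distribʳ-∑ r (f ∘ Fin.suc) c))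

∑≡sum : ∀ r (f : Fin r → ℕ) → ∑ r f ≡ sum f
∑≡sum zero    f = refl
∑≡sum (suc r) f = cong (f Fin.zero +_) (∑≡sum r (f ∘ Fin.suc))

∑-punchIn-≤ : ∀ r (f : Fin (suc r) → ℕ) i → ∑ r (f ∘ punchIn i) ≤ ∑ (suc r) f
∑-punchIn-≤ r f i = begin
  ∑ r (f ∘ punchIn i)          ≤⟨ m≤n+m _ (f i) ⟩
  f i + ∑ r (f ∘ punchIn i)    ≡⟨ cong (f i +_) (∑≡sum r _) ⟩
  f i + sum (f ∘ punchIn i)    ≡⟨ sum-remove f ⟨
  sum f                        ≡⟨ ∑≡sum (suc r) f ⟨
  ∑ (suc r) f                  ∎
  where open ≤-Reasoning

encode : (ns : Fin r → ℕ) (d : Fin r) → Fin (ns d) → Fin (∑ r ns)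
encode ns Fin.zero    v = v ↑ˡ _
encode ns (Fin.suc d) v = ns Fin.zero ↑ʳ encode (ns ∘ Fin.suc) d v

↑ˡ≢↑ʳ : ∀ {m n} (i : Fin m) (j : Fin n) → i ↑ˡ n ≢ m ↑ʳ j
↑ˡ≢↑ʳ {m} {n} i j e with trans (sym (splitAt-↑ˡ m i n)) (trans (cong (splitAt m) e) (splitAt-↑ʳ m n j))
... | ()

encode-injectiveˡ : (ns : Fin r → ℕ) {d d′ : Fin r} {v : Fin (ns d)} {v′ : Fin (ns d′)} →
                    encode ns d v ≡ encode ns d′ v′ → d ≡ d′
encode-injectiveˡ ns {Fin.zero}  {Fin.zero}   _ = refl
encode-injectiveˡ ns {Fin.zero}  {Fin.suc _}  e = ⊥-elim (↑ˡ≢↑ʳ _ _ e)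
encode-injectiveˡ ns {Fin.suc _} {Fin.zero}   e = ⊥-elim (↑ˡ≢↑ʳ _ _ (sym e))
encode-injectiveˡ ns {Fin.suc _} {Fin.suc _}  e =
  cong Fin.suc (encode-injectiveˡ (ns ∘ Fin.suc) (↑ʳ-injective (ns Fin.zero) _ _ e))

encode-injectiveʳ : (ns : Fin r → ℕ) {d : Fin r} {v v′ : Fin (ns d)} →
                    encode ns d v ≡ encode ns d v′ → v ≡ v′
encode-injectiveʳ ns {Fin.zero}  e = ↑ˡ-injective _ _ _ e
encode-injectiveʳ ns {Fin.suc d} e = encode-injectiveʳ (ns ∘ Fin.suc) (↑ʳ-injective (ns Fin.zero) _ _ e)

cases-at : ∀ {n} {P : Fin n → Set ℓ} (i : Fin n) → P i → (∀ t → t ≢ i → P t) → ∀ t → P t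
cases-at i Pi P≢ t with t ≟ᶠ i
... | yes refl = Pi
... | no  t≢i  = P≢ t t≢i

punchIn-elim : ∀ {n} {P : Fin (suc n) → Set ℓ} (i : Fin (suc n)) →
               P i → (∀ t → P (punchIn i t)) → ∀ t → P t
punchIn-elim {P = P} i Pi P↑ = cases-at i Pi (λ t t≢i → subst P (punchIn-punchOut (t≢i ∘ sym)) (P↑ _))

Point : (r : ℕ) → (Fin r → ℕ) → Set
Point r ns = V (KProd r ns)

module _ {r : ℕ} {ns : Fin r → ℕ} where

  DifferOnlyAt : Fin r → Point r ns → Point r ns → Set
  DifferOnlyAt i x y = x i ≢ y i × (∀ t → t ≢ i → x t ≡ y t)

  DifferExactlyAt : Fin r → Fin r → Point r ns → Point r ns → Set
  DifferExactlyAt i j x y = i ≢ j × x i ≢ y i × x j ≢ y j × (∀ t → t ≢ i → t ≢ j → x t ≡ y t)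

  AtDistanceTwo : Point r ns → Point r ns → Set
  AtDistanceTwo x y = ∃₂ λ i j → DifferExactlyAt i j x y

  DistanceTwoFree : List (Point r ns) → Set
  DistanceTwoFree X = ∀ {x y} → x ∈ X → y ∈ X → ¬ AtDistanceTwo x y

  differOnlyAt? : ∀ i x y → Dec (DifferOnlyAt i x y)
  differOnlyAt? i x y = ¬? (x i ≟ᶠ y i) ×-dec allᶠ? (λ t → ¬? (t ≟ᶠ i) →-dec (x t ≟ᶠ y t))

  DifferOnlyAt-sym : ∀ {i x y} → DifferOnlyAt i x y → DifferOnlyAt i y x
  DifferOnlyAt-sym (xi≢yi , x≈y) = xi≢yi ∘ sym , λ t t≢i → sym (x≈y t t≢i)

  DifferOnlyAt-respʳ : ∀ {i x y z} → DifferOnlyAt i x y → (∀ t → y t ≡ z t) → DifferOnlyAt i x z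
  DifferOnlyAt-respʳ (xi≢yi , x≈y) y≈z =
    (λ xi≡zi → xi≢yi (trans xi≡zi (sym (y≈z _)))) , λ t t≢i → trans (x≈y t t≢i) (y≈z t)

  DifferOnlyAt-unique : ∀ {i k x y} → DifferOnlyAt k x y → x i ≢ y i → i ≡ k
  DifferOnlyAt-unique (_ , x≈y) xi≢yi = decidable-stable (_ ≟ᶠ _) (λ i≢k → xi≢yi (x≈y _ i≢k))

  _[_←_] : Point r ns → Fin r → Point r ns → Point r ns
  (x [ i ← y ]) t with t ≟ᶠ i
  ... | yes _ = y t
  ... | no  _ = x t

  [←]-here : ∀ x i y → (x [ i ← y ]) i ≡ y i
  [←]-here x i y with i ≟ᶠ i
  ... | yes _  = refl
  ... | no i≢i = contradiction refl i≢i

  [←]-there : ∀ x i y {t} → t ≢ i → (x [ i ← y ]) t ≡ x t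
  [←]-there x i y {t} t≢i with t ≟ᶠ i
  ... | yes t≡i = contradiction t≡i t≢i
  ... | no  _   = refl

  [←]-DifferOnlyAt : ∀ {x y i} → x i ≢ y i → DifferOnlyAt i x (x [ i ← y ])
  [←]-DifferOnlyAt {x} {y} {i} xi≢yi =
    (λ e → xi≢yi (trans e ([←]-here x i y))) , λ t t≢i → sym ([←]-there x i y t≢i)

  module _ {i j : Fin r} {x y : Point r ns} (i≢j : i ≢ j) (xi≢yi : x i ≢ y i) (xj≢yj : x j ≢ y j)
           (x≈y : ∀ t → t ≢ i → t ≢ j → x t ≡ y t) where

    private
      u v : Point r ns
      u = x [ i ← y ]
      v = x [ j ← y ]

    corners-differ-at-i : u i ≢ v i
    corners-differ-at-i e = xi≢yi (sym (trans (sym ([←]-here x i y)) (trans e ([←]-there x j y i≢j))))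

    corners-differ-at-j : u j ≢ v j
    corners-differ-at-j e = xj≢yj (trans (sym ([←]-there x i y (i≢j ∘ sym))) (trans e ([←]-here x j y)))

    middle-vertex : ∀ {k l m} → DifferOnlyAt k u m → DifferOnlyAt l m v →
                    (∀ t → x t ≡ m t) ⊎ (∀ t → y t ≡ m t)
    middle-vertex {k} {l} {m} (_ , u≈m) m~v@(_ , m≈v) with k ≟ᶠ i
    ... | yes refl = inj₁ (cases-at j (sym mj≡xj) x≈m)
      where
      mj≡xj : m j ≡ x j
      mj≡xj = trans (sym (u≈m j (i≢j ∘ sym))) ([←]-there x i y (i≢j ∘ sym))
      j≡l : j ≡ l
      j≡l = DifferOnlyAt-unique m~v (λ e → xj≢yj (trans (sym mj≡xj) (trans e ([←]-here x j y))))
      x≈m : ∀ t → t ≢ j → x t ≡ m t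
      x≈m t t≢j =
        trans (sym ([←]-there x j y t≢j)) (sym (m≈v t (λ t≡l → t≢j (trans t≡l (sym j≡l)))))
    ... | no k≢i = inj₂ (cases-at i (sym mi≡yi) y≈m)
      where
      mi≡yi : m i ≡ y i
      mi≡yi = trans (sym (u≈m i (k≢i ∘ sym))) ([←]-here x i y)
      i≡l : i ≡ l
      i≡l = DifferOnlyAt-unique m~v
              (λ e → xi≢yi (sym (trans (sym mi≡yi) (trans e ([←]-there x j y i≢j)))))
      v≈y : ∀ t → t ≢ i → v t ≡ y t
      v≈y = cases-at j (λ _ → [←]-here x j y)
                       (λ t t≢j t≢i → trans ([←]-there x j y t≢j) (x≈y t t≢i t≢j))
      y≈m : ∀ t → t ≢ i → y t ≡ m t
      y≈m t t≢i = sym (trans (m≈v t (λ t≡l → t≢i (trans t≡l (sym i≡l)))) (v≈y t t≢i))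

    walk-via-x : Walk (KProd r ns) u v
    walk-via-x = step (i , DifferOnlyAt-sym ([←]-DifferOnlyAt xi≢yi))
                      (step (j , [←]-DifferOnlyAt xj≢yj) (stop λ _ → refl))

    no-short-avoiding-walk : ∀ {X} → x ∈ X → y ∈ X → (w : Walk (KProd r ns) u v) →
                             len (KProd r ns) w ≤ 2 → ¬ InternalAvoid (KProd r ns) X w
    no-short-avoiding-walk _ _ (stop u≈v) _ _ = corners-differ-at-i (u≈v i)
    no-short-avoiding-walk _ _ (step (_ , u~m) (stop m≈v)) _ _ =
      i≢j (trans (DifferOnlyAt-unique u~v corners-differ-at-i) (sym (DifferOnlyAt-unique u~v corners-differ-at-j)))
      where u~v = DifferOnlyAt-respʳ u~m m≈v
    no-short-avoiding-walk x∈X y∈X (step (_ , u~m) (step (_ , m~m′) (stop m′≈v))) _ (m∉X , _)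
      with middle-vertex u~m (DifferOnlyAt-respʳ m~m′ m′≈v)
    ... | inj₁ x≈m = m∉X (Any.map (λ { refl → x≈m }) x∈X)
    ... | inj₂ y≈m = m∉X (Any.map (λ { refl → y≈m }) y∈X)
    no-short-avoiding-walk _ _ (step _ (step _ (step _ _))) (s≤s (s≤s ())) _

  TotalMutualVisibility⇒DistanceTwoFree : ∀ {X} → TotalMutualVisibility (KProd r ns) X → DistanceTwoFree X
  TotalMutualVisibility⇒DistanceTwoFree tmv {x} {y} x∈X y∈X (i , j , i≢j , xi≢yi , xj≢yj , x≈y)
    with w , shortest , avoids ← tmv (x [ i ← y ]) (x [ j ← y ])
    = no-short-avoiding-walk i≢j xi≢yi xj≢yj x≈y x∈X y∈X w
        (shortest (walk-via-x i≢j xi≢yi xj≢yj x≈y)) avoids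

module _ {r : ℕ} {ns : Fin (suc r) → ℕ} (X : List (Point (suc r) ns)) where

  HasPartner : Point (suc r) ns → Fin (suc r) → Set
  HasPartner x d = Any (DifferOnlyAt d x) X

  GoodDirection : Point (suc r) ns → Fin (suc r) → Set
  GoodDirection x d = HasPartner x d ⊎ (∀ l → l ≢ d → ¬ HasPartner x l)

  goodDirection : ∀ x → ∃ (GoodDirection x)
  goodDirection x with anyᶠ? (λ d → any? (differOnlyAt? d x) X)
  ... | yes (d , partner) = d , inj₁ partner
  ... | no  no-partner    = Fin.zero , inj₂ (λ l _ partner → no-partner (l , partner))

encode-coordinate : ∀ {r} {ns : Fin r → ℕ} {x y : Point r ns} {d d′} →
                    encode ns d (x d) ≡ encode ns d′ (y d′) → x d ≡ y d
encode-coordinate {ns = ns} {d = d} {d′} e with encode-injectiveˡ ns {d} {d′} e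
... | refl = encode-injectiveʳ ns e

partners-at-distance-two : ∀ {r} {ns : Fin r → ℕ} {d l} {x x′ y : Point r ns} →
                           DifferOnlyAt d x x′ → x d ≡ y d → DifferOnlyAt l x y → l ≢ d →
                           AtDistanceTwo x′ y
partners-at-distance-two {d = d} {l} (xd≢x′d , x≈x′) xd≡yd (xl≢yl , x≈y) l≢d =
  d , l , l≢d ∘ sym , (λ x′d≡yd → xd≢x′d (trans xd≡yd (sym x′d≡yd))) ,
  (λ x′l≡yl → xl≢yl (trans (x≈x′ l l≢d) x′l≡yl)) ,
  λ t t≢d t≢l → trans (sym (x≈x′ t t≢d)) (x≈y t t≢l)

module _ {ns : Fin 3 → ℕ} (d : Fin 3) where

  private
    a b : Fin 3
    a = punchIn d Fin.zero
    b = punchIn d (Fin.suc Fin.zero)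

    a≢b : a ≢ b
    a≢b a≡b with punchIn-injective d _ _ a≡b
    ... | ()

    by-coordinates : ∀ {P : Fin 3 → Set} → P d → P a → P b → ∀ t → P t
    by-coordinates Pd Pa Pb = punchIn-elim d Pd λ { Fin.zero → Pa ; (Fin.suc Fin.zero) → Pb }

    ≢-irrefl : ∀ {t : Fin 3} {B : Set} → t ≢ t → B
    ≢-irrefl t≢t = contradiction refl t≢t

  agreeing-neighbour : ∀ {x y : Point 3 ns} → x d ≡ y d → ¬ (∀ t → x t ≡ y t) →
                       ¬ AtDistanceTwo x y → ∃ λ l → l ≢ d × DifferOnlyAt l x y
  agreeing-neighbour {x} {y} xd≡yd x≉y not-at-distance-two with x a ≟ᶠ y a | x b ≟ᶠ y b
  ... | yes xa≡ya | yes xb≡yb = ⊥-elim (x≉y (by-coordinates xd≡yd xa≡ya xb≡yb))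
  ... | no  xa≢ya | no  xb≢yb = ⊥-elim (not-at-distance-two
    (a , b , a≢b , xa≢ya , xb≢yb , by-coordinates (λ _ _ → xd≡yd) ≢-irrefl (λ _ → ≢-irrefl)))
  ... | no  xa≢ya | yes xb≡yb =
    a , punchInᵢ≢i d _ , xa≢ya , by-coordinates (λ _ → xd≡yd) ≢-irrefl (λ _ → xb≡yb)
  ... | yes xa≡ya | no  xb≢yb =
    b , punchInᵢ≢i d _ , xb≢yb , by-coordinates (λ _ → xd≡yd) (λ _ → xa≡ya) ≢-irrefl

module _ {ns : Fin 3 → ℕ} (X : List (Point 3 ns)) (X-free : DistanceTwoFree X) where

  private
    direction : Point 3 ns → Fin 3
    direction x = proj₁ (goodDirection X x)

  code : Point 3 ns → Fin (∑ 3 ns)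
  code x = encode ns (direction x) (x (direction x))

  code-injective : ∀ {x y} → x ∈ X → y ∈ X → ¬ (∀ t → x t ≡ y t) → code x ≢ code y
  code-injective {x} {y} x∈X y∈X x≉y code-x≡code-y =
    excluded (agreeing-neighbour d xd≡yd x≉y (X-free x∈X y∈X)) (proj₂ (goodDirection X x))
    where
    d = direction x
    xd≡yd : x d ≡ y d
    xd≡yd = encode-coordinate {ns = ns} {x} {y} {d} {direction y} code-x≡code-y
    excluded : (∃ λ l → l ≢ d × DifferOnlyAt l x y) → ¬ GoodDirection X x d
    excluded (l , l≢d , x~y) (inj₁ partner) =
      let x′ , x′∈X , x~x′ = find partner
      in  X-free x′∈X y∈X (partners-at-distance-two x~x′ xd≡yd x~y l≢d)
    excluded (l , l≢d , x~y) (inj₂ lonely) = lonely l l≢d (lose y∈X x~y)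

  DistanceTwoFree₃-length≤∑ : DistinctVerts (KProd 3 ns) X → length X ≤ ∑ 3 ns
  DistanceTwoFree₃-length≤∑ distinct = begin
    length X             ≡⟨ length-map code X ⟨
    length (map code X)  ≤⟨ Unique⇒length≤ (AllPairsₚ.map⁺ (AllPairs-mapWith∈ distinct code-injective)) ⟩
    ∑ 3 ns               ∎
    where open ≤-Reasoning

module _ {r : ℕ} {ns : Fin (suc r) → ℕ} where

  removeAt : Point (suc r) ns → (i : Fin (suc r)) → Point r (ns ∘ punchIn i)
  removeAt x i t = x (punchIn i t)

  ≈-removeAt : ∀ {x y i} → x i ≡ y i → (∀ t → removeAt x i t ≡ removeAt y i t) →
               ∀ t → x t ≡ y t
  ≈-removeAt {i = i} = punchIn-elim i

  AtDistanceTwo-removeAt : ∀ {x y i} → x i ≡ y i → AtDistanceTwo (removeAt x i) (removeAt y i) →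
                           AtDistanceTwo x y
  AtDistanceTwo-removeAt {i = i} xi≡yi (k , l , k≢l , xk≢yk , xl≢yl , x≈y) =
    punchIn i k , punchIn i l , k≢l ∘ punchIn-injective i k l , xk≢yk , xl≢yl ,
    punchIn-elim i (λ _ _ → xi≡yi)
                   (λ t t≢k t≢l → x≈y t (t≢k ∘ cong (punchIn i)) (t≢l ∘ cong (punchIn i)))

  layer : (i : Fin (suc r)) → ℕ → List (Point (suc r) ns) → List (Point r (ns ∘ punchIn i))
  layer i v X = map (λ x → removeAt x i) (fibre (λ x → toℕ (x i)) v X)

  module _ {X : List (Point (suc r) ns)} (i : Fin (suc r)) (v : ℕ) where

    private
      key : Point (suc r) ns → ℕ
      key x = toℕ (x i)

      ∈-layer⁻ : ∀ {x} → x ∈ fibre key v X → x ∈ X × key x ≡ v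
      ∈-layer⁻ = ∈-fibre⁻ key {v} {X}

      same-layer : ∀ {x y} → x ∈ fibre key v X → y ∈ fibre key v X → x i ≡ y i
      same-layer x∈ y∈ = toℕ-injective (trans (proj₂ (∈-layer⁻ x∈)) (sym (proj₂ (∈-layer⁻ y∈))))

    layer-distinct : DistinctVerts (KProd (suc r) ns) X → DistinctVerts (KProd r (ns ∘ punchIn i)) (layer i v X)
    layer-distinct distinct = AllPairsₚ.map⁺ (AllPairs-mapWith∈ (AllPairsₚ.filter⁺ _ distinct)
      λ x∈ y∈ x≉y x′≈y′ → x≉y (≈-removeAt (same-layer x∈ y∈) x′≈y′))

    layer-DistanceTwoFree : DistanceTwoFree X → DistanceTwoFree (layer i v X)
    layer-DistanceTwoFree X-free x′∈ y′∈ with ∈-map⁻ _ x′∈ | ∈-map⁻ _ y′∈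
    ... | x , x∈ , refl | y , y∈ , refl =
      X-free (proj₁ (∈-layer⁻ x∈)) (proj₁ (∈-layer⁻ y∈)) ∘ AtDistanceTwo-removeAt (same-layer x∈ y∈)

DistanceTwoFree-length-bound : ∀ k {ns : Fin (3 + k) → ℕ} {X : List (Point (3 + k) ns)} →
                               DistinctVerts (KProd (3 + k) ns) X → DistanceTwoFree X →
                               (3 + k) ! * length X ≤ 6 * ∑ (3 + k) ns ^ (1 + k)
DistanceTwoFree-length-bound zero    {ns} {X} distinct X-free =
  *-monoʳ-≤ 6 (≤-trans (DistanceTwoFree₃-length≤∑ X X-free distinct) (≤-reflexive (sym (*-identityʳ _))))
DistanceTwoFree-length-bound (suc k) {ns} {X} distinct X-free = begin
  (4 + k) ! * length X                      ≡⟨ *-assoc (4 + k) ((3 + k) !) (length X) ⟩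
  (4 + k) * ((3 + k) ! * length X)          ≡⟨ ∑-const (4 + k) ((3 + k) ! * length X) ⟨
  ∑ (4 + k) (λ _ → (3 + k) ! * length X)    ≤⟨ ∑-mono-≤ (4 + k) layered-bound ⟩
  ∑ (4 + k) (λ i → ns i * B)                ≡⟨ *-distribʳ-∑ (4 + k) ns B ⟨
  N * (6 * N ^ (1 + k))                     ≡⟨ x∙yz≈y∙xz N 6 _ ⟩
  6 * N ^ (2 + k)                           ∎
  where
  open ≤-Reasoning
  N = ∑ (4 + k) ns
  B = 6 * N ^ (1 + k)
  layered-bound : ∀ i → (3 + k) ! * length X ≤ ns i * B
  layered-bound i =
    *-length-≤-fibres (λ x → toℕ (x i)) {(3 + k) !} {B} (ns i) {X}
                      (All.tabulate (λ {x} _ → toℕ<n (x i))) λ v _ →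
    begin
      (3 + k) ! * length (fibre (λ x → toℕ (x i)) v X)
        ≡⟨ cong ((3 + k) ! *_) (length-map _ (fibre (λ x → toℕ (x i)) v X)) ⟨
      (3 + k) ! * length (layer i v X)
        ≤⟨ DistanceTwoFree-length-bound k (layer-distinct i v distinct) (layer-DistanceTwoFree i v X-free) ⟩
      6 * ∑ (3 + k) (ns ∘ punchIn i) ^ (1 + k)
        ≤⟨ *-monoʳ-≤ 6 (^-monoˡ-≤ (1 + k) (∑-punchIn-≤ (3 + k) ns i)) ⟩
      B
    ∎

^-distribʳ-* : ∀ m n o → (m * n) ^ o ≡ m ^ o * n ^ o
^-distribʳ-* m n zero    = refl
^-distribʳ-* m n (suc o) = trans (cong (m * n *_) (^-distribʳ-* m n o)) (interchange m n (m ^ o) (n ^ o))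

c′-bound : ∀ k → 6 * (3 + k) ^ (1 + k) ≤ (3 + k) ! * c′ (3 + k)
c′-bound zero    = ≤-refl
c′-bound (suc k) = begin
  6 * ((4 + k) * (4 + k) ^ (1 + k))
    ≤⟨ *-monoʳ-≤ 6 (*-monoʳ-≤ (4 + k) (^-monoˡ-≤ (1 + k) (m<m*n (3 + k) (3 + k) (s≤s (s≤s z≤n))))) ⟩
  6 * ((4 + k) * ((3 + k) * (3 + k)) ^ (1 + k))
    ≡⟨ cong (λ z → 6 * ((4 + k) * z)) (^-distribʳ-* (3 + k) (3 + k) (1 + k)) ⟩
  6 * ((4 + k) * (P * P))
    ≡⟨ solve 3 (λ m p q → con 6 :* (m :* (p :* q)) := m :* (p :* (con 6 :* q))) refl (4 + k) P P ⟩
  (4 + k) * (P * (6 * P))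
    ≤⟨ *-monoʳ-≤ (4 + k) (*-monoʳ-≤ P (c′-bound k)) ⟩
  (4 + k) * (P * ((3 + k) ! * (3 * ∏c (3 + k))))
    ≡⟨ solve 4 (λ m p f c → m :* (p :* (f :* (con 3 :* c))) := (m :* f) :* (con 3 :* (p :* c)))
             refl (4 + k) P ((3 + k) !) (∏c (3 + k)) ⟩
  (4 + k) ! * c′ (4 + k)
  ∎
  where
  open ≤-Reasoning
  open +-*-Solver
  P = (3 + k) ^ (1 + k)

KProd-visibility-bound : ∀ k {ns : Fin (3 + k) → ℕ} {X : List (V (KProd (3 + k) ns))} →
                         DistinctVerts (KProd (3 + k) ns) X → TotalMutualVisibility (KProd (3 + k) ns) X →
                         (3 + k) ! * length X ≤ 6 * ∑ (3 + k) ns ^ (1 + k)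
KProd-visibility-bound k distinct tmv =
  DistanceTwoFree-length-bound k distinct (TotalMutualVisibility⇒DistanceTwoFree tmv)

KPow-visibility-bound : ∀ k s {X : List (V (KPow s (3 + k)))} →
                        DistinctVerts (KPow s (3 + k)) X → TotalMutualVisibility (KPow s (3 + k)) X →
                        length X ≤ c′ (3 + k) * s ^ (1 + k)
KPow-visibility-bound k s {X} distinct tmv = *-cancelˡ-≤ ((3 + k) !) {{(3 + k) !≢0}} (begin
  (3 + k) ! * length X                    ≤⟨ KProd-visibility-bound k distinct tmv ⟩
  6 * ∑ (3 + k) (λ _ → s) ^ (1 + k)       ≡⟨ cong (λ N → 6 * N ^ (1 + k)) (∑-const (3 + k) s) ⟩
  6 * ((3 + k) * s) ^ (1 + k)             ≡⟨ cong (6 *_) (^-distribʳ-* (3 + k) s (1 + k)) ⟩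
  6 * ((3 + k) ^ (1 + k) * s ^ (1 + k))   ≡⟨ *-assoc 6 ((3 + k) ^ (1 + k)) (s ^ (1 + k)) ⟨
  6 * (3 + k) ^ (1 + k) * s ^ (1 + k)     ≤⟨ *-monoˡ-≤ (s ^ (1 + k)) (c′-bound k) ⟩
  (3 + k) ! * c′ (3 + k) * s ^ (1 + k)    ≡⟨ *-assoc ((3 + k) !) (c′ (3 + k)) (s ^ (1 + k)) ⟩
  (3 + k) ! * (c′ (3 + k) * s ^ (1 + k))  ∎)
  where open ≤-Reasoning

theorem1p2 : (r : ℕ) → 3 ≤ r →
    ((ns : Fin r → ℕ) → ((i : Fin r) → 0 < ns i) →
      (X : List (V (KProd r ns))) → DistinctVerts (KProd r ns) X →
      TotalMutualVisibility (KProd r ns) X →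
      (r !) * length X ≤ 6 * (∑ r ns) ^ (r ∸ 2))
    ×
    ((s : ℕ) → 0 < s →
      (X : List (V (KPow s r))) → DistinctVerts (KPow s r) X →
      TotalMutualVisibility (KPow s r) X →
      length X ≤ c′ r * s ^ (r ∸ 2))
theorem1p2 (suc (suc (suc k))) (s≤s (s≤s (s≤s _))) =
  (λ _ _ _ → KProd-visibility-bound k) , (λ s _ _ → KPow-visibility-bound k s)
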